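{- Let $\mathbb P$ be a perfect-tree forcing notion. If $\mathbb P$ is special and $S,T\in\mathbb P$ are not almost disjoint, then $S\subseteq T$ or $T\subseteq S$. If $\mathbb P$ is special then $\mathbb P$ is regular. If $\mathbb P$ is regular, then: (i) if $S,T\in\mathbb P$ are not almost disjoint, then there is $R\in\mathbb P$ with $R\subseteq S\cap T$; (ii) if $S_1,\dots,S_k\in\mathbb P$ then there is a finite set of pairwise almost disjoint trees $R_1,\dots,R_n\in\mathbb P$ such that $[S_1]\cap\dots\cap[S_k]=[R_1]\cup\dots\cup[R_n]$; (iii) if $\mathcal S_1,\dots,\mathcal S_k$ are finite collections of trees in $\mathbb P$, then there is a finite set of trees $R_1,\dots,R_n\in\mathbb P$ such that $\bigcup_{S\in\mathcal S_1}[S]\cap\dots\cap\bigcup_{S\in\mathcal S_k}[S]=[R_1]\cup\dots\cup[R_n]$, and for every $i$ and $j$ there is $S\in\mathcal S_i$ with $R_j\subseteq S$.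
   Context: $2^{<\omega}$ is the set of finite binary strings. A tree is a set $T\subseteq 2^{<\omega}$ closed under initial segments; it is perfect if it is non-empty, has no endpoints and no isolated branches. For a perfect tree $T$, $[T]=\{a\in 2^\omega:\forall n\,(a\restriction n\in T)\}$, and for $s\in T$, $T\restriction s=\{t\in T: s\subseteq t\text{ or }t\subseteq s\}$. Perfect trees $S,T$ are almost disjoint if $S\cap T$ is finite, equivalently $[S]\cap[T]=\emptyset$. A perfect-tree forcing notion is a non-empty set $\mathbb P$ of perfect trees such that $s\in T\in\mathbb P$ implies $T\restriction s\in\mathbb P$. $\mathbb P$ is special if there is a set $A\subseteq\mathbb P$ of pairwise almost disjoint trees with $\mathbb P=\{T\restriction s: s\in T\in A\}$. $\mathbb P$ is regular if for all $S,T\in\mathbb P$ the set $[S]\cap[T]$ is clopen in $[S]$ or clopen in $[T]$. -}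

module Defs where

open import Data.Bool using (Bool; true; false; _∧_; _∨_; _≟_)
open import Data.List using (List; []; _∷_; _∷ʳ_)
open import Data.List.Membership.Propositional using (_∈_)
open import Data.Nat using (ℕ; zero; suc)
open import Data.Fin using (Fin)
open import Data.Product using (Σ; ∃; ∃-syntax; _×_; _,_)
open import Data.Sum using (_⊎_)
open import Relation.Nullary using (¬_; does)
open import Relation.Binary.PropositionalEquality using (_≡_; _≢_)
open import Function.Bundles using (_⇔_)

Str : Set
Str = List Bool

Seq : Set
Seq = ℕ → Bool

isPrefix : Str → Str → Bool
isPrefix [] t = true
isPrefix (x ∷ s) [] = false
isPrefix (x ∷ s) (y ∷ t) = does (x ≟ y) ∧ isPrefix s t

_⊑_ : Str → Str → Set
s ⊑ t = isPrefix s t ≡ true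

_↾_ : Seq → ℕ → Str
a ↾ zero = []
a ↾ suc n = a zero ∷ ((λ k → a (suc k)) ↾ n)

-- A (candidate) tree is a subset of 2^{<ω}, given by its characteristic function.
Tree : Set
Tree = Str → Bool

_∈T_ : Str → Tree → Set
s ∈T T = T s ≡ true

IsTree : Tree → Set
IsTree T = ∀ s t → s ⊑ t → t ∈T T → s ∈T T

Body : Tree → Seq → Set
Body T a = ∀ n → (a ↾ n) ∈T T

IsPerfect : Tree → Set
IsPerfect T =
  IsTree T
  × (∃[ s ] s ∈T T)
  × (∀ s → s ∈T T → ∃[ b ] (s ∷ʳ b) ∈T T)
  × (∀ a → Body T a → ∀ n →
       ∃[ c ] (Body T c × ¬ (∀ k → c k ≡ a k) × (c ↾ n) ≡ (a ↾ n)))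

_∣_ : Tree → Str → Tree
(T ∣ s) t = T t ∧ (isPrefix s t ∨ isPrefix t s)

_⊆T_ : Tree → Tree → Set
S ⊆T T = ∀ s → s ∈T S → s ∈T T

_≐_ : Tree → Tree → Set
S ≐ T = S ⊆T T × T ⊆T S

AlmostDisjoint : Tree → Tree → Set
AlmostDisjoint S T = ∃[ L ] (∀ s → s ∈T S → s ∈T T → s ∈ L)

-- A perfect-tree forcing notion: a non-empty set of perfect trees closed
-- under T ↦ T ↾ s (s ∈ T).  As a *set* of trees, it is extensional.
IsForcingNotion : (Tree → Set) → Set
IsForcingNotion P =
  (∃[ T ] P T)
  × (∀ T → P T → IsPerfect T)
  × (∀ T s → P T → s ∈T T → P (T ∣ s))
  × (∀ S T → S ≐ T → P S → P T)

Special : (Tree → Set) → Set₁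
Special P =
  Σ (Tree → Set) λ A →
    (∀ T → A T → P T)
    × (∀ S T → A S → A T → ¬ (S ≐ T) → AlmostDisjoint S T)
    × (∀ T → P T ⇔ (∃[ S ] ∃[ s ] (A S × s ∈T S × T ≐ (S ∣ s))))

OpenIn : (Seq → Set) → (Seq → Set) → Set
OpenIn X U = ∀ a → X a → U a → ∃[ n ] (∀ b → X b → (b ↾ n) ≡ (a ↾ n) → U b)

ClopenIn : (Seq → Set) → (Seq → Set) → Set
ClopenIn X U = OpenIn X U × OpenIn X (λ a → ¬ U a)

BodyMeet : Tree → Tree → Seq → Set
BodyMeet S T a = Body S a × Body T a

Regular : (Tree → Set) → Set
Regular P = ∀ S T → P S → P T →
  ClopenIn (Body S) (BodyMeet S T) ⊎ ClopenIn (Body T) (BodyMeet S T)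

module Submission where

-- Two facts carry the proof.  (1) A tree R of a forcing notion P is
-- determined by its branches: each node s of R lies on a branch, since R ∣ s
-- is again perfect; so [R] ⊆ [S] implies R ⊆ S.  (2) König's lemma (classical):
-- a set of strings closed under initial segments without infinite branch
-- misses all strings of some length N.  By König, almost disjointness is
-- disjointness of bodies, and a relatively clopen U ⊆ [X] depends only on the
-- first N bits, so it is the disjoint union of the bodies of the finitely
-- many restrictions X ∣ t (t of length N) meeting it.
--
-- For special P, write S ≐ S′ ∣ s and T ≐ T′ ∣ t with S′, T′ in the antichain;
-- unless S, T are almost disjoint we get S′ = T′ and s, t comparable, so S, T
-- are comparable, and [S] ∩ [T] (empty or a whole body) is clopen.  For
-- regular P, [S] ∩ [T] is partitioned by trees of P below S and T; (i) takes
-- one piece, and (ii), (iii) refine a partition (resp. cover) one tree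
-- (resp. one finite union) at a time.

open import Defs
open import Axiom.ExcludedMiddle using (ExcludedMiddle)
open import Level using (0ℓ)
open import Data.Nat using (ℕ; suc)
open import Data.Fin using (Fin)
open import Data.Product using (Σ; ∃; ∃-syntax; _×_; _,_)
open import Data.Sum using (_⊎_)
open import Relation.Nullary using (¬_)
open import Relation.Binary.PropositionalEquality using (_≢_)
open import Function.Bundles using (_⇔_)

open import Axiom.DoubleNegationElimination using (em⇒dne)
open import Data.Bool using (Bool; true; false; _∧_; _∨_)
import Data.Bool as Bool
open import Data.Empty using (⊥; ⊥-elim)
open import Data.Fin using (zero; suc)
open import Data.List using (List; []; _∷_; _∷ʳ_; _++_; length; map; filter; tabulate; lookup)
open import Data.List.Properties using (length-++)
open import Data.List.Membership.Propositional using (_∈_; lose)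
open import Data.List.Membership.Propositional.Properties
  using (∈-++⁺ˡ; ∈-++⁺ʳ; ∈-map⁺; ∈-map⁻; ∈-filter⁺; ∈-filter⁻; ∈-lookup)
open import Data.List.Relation.Unary.All as All using (All; []; _∷_)
import Data.List.Relation.Unary.All.Properties as All
open import Data.List.Relation.Unary.Any as Any using (Any; here; there)
import Data.List.Relation.Unary.Any.Properties as Any
open import Data.List.Relation.Unary.AllPairs as AllPairs using (AllPairs; []; _∷_)
import Data.List.Relation.Unary.AllPairs.Properties as AllPairs
open import Data.Nat using (zero; _≤_; z≤n; s≤s; _⊔_; _≤?_)
open import Data.Nat.Properties
  using (suc-injective; ≤-total; ≤-trans; <⇒≤; ≰⇒>; 1+n≰n; m≤m⊔n; m≤n⊔m; +-comm; m≤n⇒m<n∨m≡n)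
open import Data.Product using (proj₁; proj₂)
open import Data.Sum using (inj₁; inj₂; swap)
open import Function.Bundles using (Equivalence; mk⇔)
open import Relation.Nullary using (Dec; yes; no)
open import Relation.Binary.PropositionalEquality
  using (_≡_; refl; sym; trans; cong; subst; subst₂; module ≡-Reasoning)

⊑-cons : ∀ x s t → s ⊑ t → (x ∷ s) ⊑ (x ∷ t)
⊑-cons true  _ _ s⊑t = s⊑t
⊑-cons false _ _ s⊑t = s⊑t

⊑-uncons : ∀ x y s t → (x ∷ s) ⊑ (y ∷ t) → x ≡ y × s ⊑ t
⊑-uncons true  true  _ _ s⊑t = refl , s⊑t
⊑-uncons false false _ _ s⊑t = refl , s⊑t
⊑-uncons true  false _ _ ()
⊑-uncons false true  _ _ ()

⊑-trans : ∀ s t u → s ⊑ t → t ⊑ u → s ⊑ u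
⊑-trans []      _       _       _ _ = refl
⊑-trans (x ∷ s) (y ∷ t) (z ∷ u) p q with ⊑-uncons x y s t p | ⊑-uncons y z t u q
... | refl , p′ | refl , q′ = ⊑-cons x s u (⊑-trans s t u p′ q′)

⊑-length : ∀ s t → s ⊑ t → length s ≤ length t
⊑-length []      _       _ = z≤n
⊑-length (x ∷ s) (y ∷ t) p = s≤s (⊑-length s t (proj₂ (⊑-uncons x y s t p)))

⊑-length-≡ : ∀ s t → s ⊑ t → length s ≡ length t → s ≡ t
⊑-length-≡ []      []      _ _ = refl
⊑-length-≡ (x ∷ s) (y ∷ t) p e with ⊑-uncons x y s t p
... | refl , p′ = cong (x ∷_) (⊑-length-≡ s t p′ (suc-injective e))

_⊑?_ : ∀ s t → Dec (s ⊑ t)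
s ⊑? t = isPrefix s t Bool.≟ true

comparable-length-≡ : ∀ s t → s ⊑ t ⊎ t ⊑ s → length s ≡ length t → s ≡ t
comparable-length-≡ s t (inj₁ s⊑t) e = ⊑-length-≡ s t s⊑t e
comparable-length-≡ s t (inj₂ t⊑s) e = sym (⊑-length-≡ t s t⊑s (sym e))

⊑-common : ∀ s t u → s ⊑ u → t ⊑ u → s ⊑ t ⊎ t ⊑ s
⊑-common []      t       _       _ _ = inj₁ refl
⊑-common (x ∷ s) []      _       _ _ = inj₂ refl
⊑-common (x ∷ s) (y ∷ t) (z ∷ u) p q with ⊑-uncons x z s u p | ⊑-uncons y z t u q
... | refl , p′ | refl , q′ with ⊑-common s t u p′ q′
...   | inj₁ s⊑t = inj₁ (⊑-cons x s t s⊑t)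
...   | inj₂ t⊑s = inj₂ (⊑-cons x t s t⊑s)

_⊏_ : Str → Seq → Set
u ⊏ a = a ↾ length u ≡ u

tail : Seq → Seq
tail a k = a (suc k)

length-↾ : ∀ a n → length (a ↾ n) ≡ n
length-↾ a zero    = refl
length-↾ a (suc n) = cong suc (length-↾ (tail a) n)

↾-⊑ : ∀ a {m n} → m ≤ n → (a ↾ m) ⊑ (a ↾ n)
↾-⊑ a {zero}          _         = refl
↾-⊑ a {suc m} {suc n} (s≤s m≤n) = ⊑-cons (a zero) (tail a ↾ m) (tail a ↾ n) (↾-⊑ (tail a) m≤n)

↾-∷ʳ : ∀ a n → a ↾ suc n ≡ (a ↾ n) ∷ʳ a n
↾-∷ʳ a zero    = refl
↾-∷ʳ a (suc n) = cong (a zero ∷_) (↾-∷ʳ (tail a) n)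

↾⊏⇒ : ∀ a b n → (a ↾ n) ⊏ b → b ↾ n ≡ a ↾ n
↾⊏⇒ a b n = subst (λ k → b ↾ k ≡ a ↾ n) (length-↾ a n)

↾⊏⇐ : ∀ a b n → b ↾ n ≡ a ↾ n → (a ↾ n) ⊏ b
↾⊏⇐ a b n = subst (λ k → b ↾ k ≡ a ↾ n) (sym (length-↾ a n))

↾-⊏ : ∀ a n → (a ↾ n) ⊏ a
↾-⊏ a n = ↾⊏⇐ a a n refl

⊑-↾⇒⊏ : ∀ s a n → s ⊑ (a ↾ n) → s ⊏ a
⊑-↾⇒⊏ s a n s⊑aₙ =
  comparable-length-≡ (a ↾ length s) s
    (⊑-common (a ↾ length s) s (a ↾ n) (↾-⊑ a |s|≤n) s⊑aₙ)
    (length-↾ a (length s))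
  where
  |s|≤n : length s ≤ n
  |s|≤n = subst (length s ≤_) (length-↾ a n) (⊑-length s (a ↾ n) s⊑aₙ)

⊏-⊑ : ∀ s u a → s ⊑ u → u ⊏ a → s ⊏ a
⊏-⊑ s u a s⊑u u⊏a = ⊑-↾⇒⊏ s a (length u) (subst (s ⊑_) (sym u⊏a) s⊑u)

⊏-comparable : ∀ s t a → s ⊏ a → t ⊏ a → s ⊑ t ⊎ t ⊑ s
⊏-comparable s t a s⊏a t⊏a with ≤-total (length s) (length t)
... | inj₁ |s|≤|t| = inj₁ (subst₂ _⊑_ s⊏a t⊏a (↾-⊑ a |s|≤|t|))
... | inj₂ |t|≤|s| = inj₂ (subst₂ _⊑_ t⊏a s⊏a (↾-⊑ a |t|≤|s|))

pad : Str → Seq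
pad []      k       = false
pad (x ∷ u) zero    = x
pad (x ∷ u) (suc k) = pad u k

pad-⊏ : ∀ u → u ⊏ pad u
pad-⊏ []      = refl
pad-⊏ (x ∷ u) = cong (x ∷_) (pad-⊏ u)

∧∨-true⁻ : ∀ x y z → x ∧ (y ∨ z) ≡ true → x ≡ true × (y ≡ true ⊎ z ≡ true)
∧∨-true⁻ true true  _    _ = refl , inj₁ refl
∧∨-true⁻ true false true _ = refl , inj₂ refl

∧∨-true⁺ : ∀ x y z → x ≡ true → y ≡ true ⊎ z ≡ true → x ∧ (y ∨ z) ≡ true
∧∨-true⁺ true true  _    _ _           = refl
∧∨-true⁺ true false true _ _           = refl
∧∨-true⁺ true false false _ (inj₁ ())
∧∨-true⁺ true false false _ (inj₂ ())

∣-∈⁻ : ∀ T s t → t ∈T (T ∣ s) → t ∈T T × (s ⊑ t ⊎ t ⊑ s)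
∣-∈⁻ T s t = ∧∨-true⁻ (T t) (isPrefix s t) (isPrefix t s)

∣-∈⁺ : ∀ T s t → t ∈T T → s ⊑ t ⊎ t ⊑ s → t ∈T (T ∣ s)
∣-∈⁺ T s t = ∧∨-true⁺ (T t) (isPrefix s t) (isPrefix t s)

∣-⊆ : ∀ T s → (T ∣ s) ⊆T T
∣-⊆ T s t t∈ = proj₁ (∣-∈⁻ T s t t∈)

∣-mono : ∀ S T s t → T ⊆T S → s ⊑ t → (T ∣ t) ⊆T (S ∣ s)
∣-mono S T s t T⊆S s⊑t u u∈ with ∣-∈⁻ T t u u∈
... | u∈T , inj₁ t⊑u = ∣-∈⁺ S s u (T⊆S u u∈T) (inj₁ (⊑-trans s t u s⊑t t⊑u))
... | u∈T , inj₂ u⊑t = ∣-∈⁺ S s u (T⊆S u u∈T) (swap (⊑-common u s t u⊑t s⊑t))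

⊆-trans : ∀ {R S T} → R ⊆T S → S ⊆T T → R ⊆T T
⊆-trans R⊆S S⊆T u u∈R = S⊆T u (R⊆S u u∈R)

Body-⊆ : ∀ S T → S ⊆T T → ∀ a → Body S a → Body T a
Body-⊆ S T S⊆T a a∈S n = S⊆T (a ↾ n) (a∈S n)

body-∣⁻ : ∀ T t b → Body (T ∣ t) b → Body T b × t ⊏ b
body-∣⁻ T t b b∈ = Body-⊆ (T ∣ t) T (∣-⊆ T t) b b∈ ,
  comparable-length-≡ (b ↾ length t) t
    (swap (proj₂ (∣-∈⁻ T t (b ↾ length t) (b∈ (length t)))))
    (length-↾ b (length t))

body-∣⁺ : ∀ T t b → Body T b → t ⊏ b → Body (T ∣ t) b
body-∣⁺ T t b b∈T t⊏b n = ∣-∈⁺ T t (b ↾ n) (b∈T n) comparable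
  where
  comparable : t ⊑ (b ↾ n) ⊎ (b ↾ n) ⊑ t
  comparable with ≤-total n (length t)
  ... | inj₁ n≤|t| = inj₂ (subst ((b ↾ n) ⊑_) t⊏b (↾-⊑ b n≤|t|))
  ... | inj₂ |t|≤n = inj₁ (subst (_⊑ (b ↾ n)) t⊏b (↾-⊑ b |t|≤n))

Disj : Tree → Tree → Set
Disj S T = ∀ a → ¬ BodyMeet S T a

Disj-sym : ∀ S T → Disj S T → Disj T S
Disj-sym S T d a (a∈T , a∈S) = d a (a∈S , a∈T)

Disj-⊆ : ∀ S T S′ T′ → Disj S T → S′ ⊆T S → T′ ⊆T T → Disj S′ T′
Disj-⊆ S T S′ T′ d S′⊆S T′⊆T a (a∈S′ , a∈T′) =
  d a (Body-⊆ S′ S S′⊆S a a∈S′ , Body-⊆ T′ T T′⊆T a a∈T′)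

Incomparable : Str → Str → Set
Incomparable s t = ¬ s ⊑ t × ¬ t ⊑ s

∣-incomparable : ∀ S T s t → Incomparable s t → Disj (S ∣ s) (T ∣ t)
∣-incomparable S T s t (s⋢t , t⋢s) b (b∈S∣s , b∈T∣t)
  with ⊏-comparable s t b (proj₂ (body-∣⁻ S s b b∈S∣s)) (proj₂ (body-∣⁻ T t b b∈T∣t))
... | inj₁ s⊑t = s⋢t s⊑t
... | inj₂ t⊑s = t⋢s t⊑s

strings : ℕ → List Str
strings zero    = [] ∷ []
strings (suc n) = map (false ∷_) (strings n) ++ map (true ∷_) (strings n)

strings-complete : ∀ u → u ∈ strings (length u)
strings-complete []          = here refl
strings-complete (false ∷ u) = ∈-++⁺ˡ (∈-map⁺ (false ∷_) (strings-complete u))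
strings-complete (true ∷ u)  =
  ∈-++⁺ʳ (map (false ∷_) (strings (length u))) (∈-map⁺ (true ∷_) (strings-complete u))

strings-incomparable : ∀ n → AllPairs Incomparable (strings n)
strings-incomparable zero    = [] ∷ []
strings-incomparable (suc n) =
  AllPairs.++⁺ (prefixed false) (prefixed true)
    (All.tabulate λ x∈ → All.tabulate λ y∈ → different-heads x∈ y∈)
  where
  prefixed : ∀ x → AllPairs Incomparable (map (x ∷_) (strings n))
  prefixed x = AllPairs.map⁺ (AllPairs.map (λ {s} {t} (s⋢t , t⋢s) →
      (λ p → s⋢t (proj₂ (⊑-uncons x x s t p))) , (λ p → t⋢s (proj₂ (⊑-uncons x x t s p))))
    (strings-incomparable n))
  different-heads : ∀ {u v} → u ∈ map (false ∷_) (strings n) → v ∈ map (true ∷_) (strings n) →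
                    Incomparable u v
  different-heads u∈ v∈ with ∈-map⁻ (false ∷_) u∈ | ∈-map⁻ (true ∷_) v∈
  ... | _ , _ , refl | _ , _ , refl = (λ ()) , (λ ())

stringsUpTo : ℕ → List Str
stringsUpTo zero    = strings zero
stringsUpTo (suc n) = strings (suc n) ++ stringsUpTo n

stringsUpTo-complete : ∀ n u → length u ≤ n → u ∈ stringsUpTo n
stringsUpTo-complete zero    [] _ = here refl
stringsUpTo-complete (suc n) u |u|≤1+n with m≤n⇒m<n∨m≡n |u|≤1+n
... | inj₁ (s≤s |u|≤n) = ∈-++⁺ʳ (strings (suc n)) (stringsUpTo-complete n u |u|≤n)
... | inj₂ |u|≡1+n      = ∈-++⁺ˡ (subst (λ k → u ∈ strings k) |u|≡1+n (strings-complete u))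

maxLength : List Str → ℕ
maxLength []      = 0
maxLength (u ∷ L) = length u ⊔ maxLength L

maxLength-≥ : ∀ {u} L → u ∈ L → length u ≤ maxLength L
maxLength-≥ (v ∷ L) (here refl) = m≤m⊔n (length v) (maxLength L)
maxLength-≥ (v ∷ L) (there u∈L) = ≤-trans (maxLength-≥ L u∈L) (m≤n⊔m (length v) (maxLength L))

-- Almost disjoint trees have no common branch: a common branch would give
-- common nodes of every length.
AD⇒Disj : ∀ S T → AlmostDisjoint S T → Disj S T
AD⇒Disj S T (L , S∩T⊆L) a (a∈S , a∈T) = 1+n≰n (subst (_≤ maxLength L) (length-↾ a n) (maxLength-≥ L aₙ∈L))
  where
  n = suc (maxLength L)
  aₙ∈L : (a ↾ n) ∈ L
  aₙ∈L = S∩T⊆L (a ↾ n) (a∈S n) (a∈T n)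

AD-⊆ : ∀ S T S′ T′ → AlmostDisjoint S T → S′ ⊆T S → T′ ⊆T T → AlmostDisjoint S′ T′
AD-⊆ S T S′ T′ (L , S∩T⊆L) S′⊆S T′⊆T = L , λ u u∈S′ u∈T′ → S∩T⊆L u (S′⊆S u u∈S′) (T′⊆T u u∈T′)

Determined : Tree → (Seq → Set) → ℕ → Set
Determined X U N = ∀ a b → Body X a → Body X b → a ↾ N ≡ b ↾ N → U a → U b

clopen-full : ∀ X U → (∀ a → X a → U a) → ClopenIn X U
clopen-full X U X⊆U = (λ _ _ _ → 0 , λ b b∈X _ → X⊆U b b∈X) , (λ a a∈X ¬Ua → ⊥-elim (¬Ua (X⊆U a a∈X)))

clopen-empty : ∀ X U → (∀ a → X a → ¬ U a) → ClopenIn X U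
clopen-empty X U X∩U=∅ = (λ a a∈X Ua → ⊥-elim (X∩U=∅ a a∈X Ua)) , (λ _ _ _ → 0 , λ b b∈X _ → X∩U=∅ b b∈X)

Cover : (Tree → Set) → (Seq → Set) → Set
Cover Good W = Σ (List Tree) λ Rs → All Good Rs × (∀ a → W a → Any (λ R → Body R a) Rs)

Partition : (Tree → Set) → (Seq → Set) → Set
Partition Good W = Σ (List Tree) λ Rs → All Good Rs × AllPairs Disj Rs × (∀ a → W a → Any (λ R → Body R a) Rs)

All-lookup : ∀ {A : Set} {Q : A → Set} {xs : List A} → All Q xs → ∀ j → Q (lookup xs j)
All-lookup Qxs j = All.lookup Qxs (∈-lookup j)

Any⇒∃lookup : ∀ {A : Set} {Q : A → Set} {xs : List A} → Any Q xs → ∃[ j ] Q (lookup xs j)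
Any⇒∃lookup q = Any.index q , Any.lookup-index q

AllPairs-lookup : ∀ {A : Set} {R : A → A → Set} → (∀ {x y} → R x y → R y x) →
  ∀ {xs : List A} → AllPairs R xs → ∀ i j → i ≢ j → R (lookup xs i) (lookup xs j)
AllPairs-lookup sym (_ ∷ _)    zero    zero    i≢j = ⊥-elim (i≢j refl)
AllPairs-lookup sym (Rx ∷ _)   zero    (suc j) _   = All-lookup Rx j
AllPairs-lookup sym (Rx ∷ _)   (suc i) zero    _   = sym (All-lookup Rx i)
AllPairs-lookup sym (_ ∷ Rxs) (suc i) (suc j) i≢j = AllPairs-lookup sym Rxs i j (λ i≡j → i≢j (cong suc i≡j))

infiniteBranch : (Q : Str → Set) → Q [] → (∀ s → Q s → Σ Bool λ b → Q (s ∷ʳ b)) →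
                 ∃[ a ] (∀ n → Q (a ↾ n))
infiniteBranch Q root child = a , λ n → subst Q (sym (a↾n≡node n)) (proj₂ (node n))
  where
  node : ℕ → Σ Str Q
  node zero    = [] , root
  node (suc n) = (proj₁ (node n) ∷ʳ proj₁ (child _ (proj₂ (node n)))) , proj₂ (child _ (proj₂ (node n)))
  a : Seq
  a n = proj₁ (child _ (proj₂ (node n)))
  a↾n≡node : ∀ n → a ↾ n ≡ proj₁ (node n)
  a↾n≡node zero    = refl
  a↾n≡node (suc n) = trans (↾-∷ʳ a n) (cong (_∷ʳ a n) (a↾n≡node n))

⊏-∷ʳ : ∀ s a → s ⊏ a → (s ∷ʳ a (length s)) ⊏ a
⊏-∷ʳ s a s⊏a = begin
  a ↾ length (s ∷ʳ a (length s))  ≡⟨ cong (a ↾_) (trans (length-++ s) (+-comm (length s) 1)) ⟩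
  a ↾ suc (length s)              ≡⟨ ↾-∷ʳ a (length s) ⟩
  (a ↾ length s) ∷ʳ a (length s)  ≡⟨ cong (_∷ʳ a (length s)) s⊏a ⟩
  s ∷ʳ a (length s)               ∎
  where open ≡-Reasoning

module Classical (em : ExcludedMiddle 0ℓ) where

  dne : {A : Set} → ¬ ¬ A → A
  dne = em⇒dne em

  ¬∀⇒∃¬ : {A : Set} {B : A → Set} → ¬ (∀ x → B x) → ∃[ x ] ¬ B x
  ¬∀⇒∃¬ ¬∀ = dne λ ¬∃ → ¬∀ λ x → dne λ ¬Bx → ¬∃ (x , ¬Bx)

  -- The proof follows
  -- the nodes with extensions in the set of every length.
  opaque
    König : (Tr : Str → Set) → (∀ s t → s ⊑ t → Tr t → Tr s) →
            (∀ a → ¬ (∀ n → Tr (a ↾ n))) → ∃[ N ] (∀ a → ¬ Tr (a ↾ N))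
    König Tr closed noBranch = dne λ unbounded →
      let (a , ext) = infiniteBranch Extendable (root unbounded) child
      in noBranch a λ n → extendable⇒Tr (a ↾ n) (ext n)
      where
      Extendable : Str → Set
      Extendable s = ∀ m → ∃[ a ] (s ⊏ a × Tr (a ↾ m))

      extendable⇒Tr : ∀ s → Extendable s → Tr s
      extendable⇒Tr s ext with ext (length s)
      ... | a , s⊏a , tr = subst Tr s⊏a tr

      root : ¬ (∃[ N ] (∀ a → ¬ Tr (a ↾ N))) → Extendable []
      root unbounded m = dne λ none → unbounded (m , λ a tr → none (a , refl , tr))

      -- If neither child of an extendable s were extendable, each would fail
      -- beyond some bound; an extension of s beyond both bounds passes
      -- through one of them.
      module NoChild (s : Str) (ext : Extendable s) (stuck : ¬ (Σ Bool λ b → Extendable (s ∷ʳ b))) where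
        dead : ∀ b → ∃[ m ] ¬ (∃[ a ] ((s ∷ʳ b) ⊏ a × Tr (a ↾ m)))
        dead b = ¬∀⇒∃¬ λ e → stuck (b , e)

        bound : ℕ
        bound = proj₁ (dead false) ⊔ proj₁ (dead true)

        bound≥ : ∀ b → proj₁ (dead b) ≤ bound
        bound≥ false = m≤m⊔n _ _
        bound≥ true  = m≤n⊔m _ _

        absurd : ⊥
        absurd with ext bound
        ... | a , s⊏a , tr =
          proj₂ (dead (a (length s))) (a , ⊏-∷ʳ s a s⊏a , closed _ _ (↾-⊑ a (bound≥ (a (length s)))) tr)

      child : ∀ s → Extendable s → Σ Bool λ b → Extendable (s ∷ʳ b)
      child s ext = dne (NoChild.absurd s ext)

  -- Conversely trees without common branch are almost disjoint: by König's
  -- lemma their common nodes have bounded length.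
  Disj⇒AD : ∀ S T → IsTree S → IsTree T → Disj S T → AlmostDisjoint S T
  Disj⇒AD S T S-tree T-tree disj = stringsUpTo N , λ u u∈S u∈T → stringsUpTo-complete N u (short u u∈S u∈T)
    where
    Common : Str → Set
    Common u = u ∈T S × u ∈T T
    closed : ∀ s t → s ⊑ t → Common t → Common s
    closed s t s⊑t (t∈S , t∈T) = S-tree s t s⊑t t∈S , T-tree s t s⊑t t∈T
    bounded : ∃[ N ] (∀ a → ¬ Common (a ↾ N))
    bounded = König Common closed λ a common → disj a ((λ n → proj₁ (common n)) , (λ n → proj₂ (common n)))
    N = proj₁ bounded
    short : ∀ u → u ∈T S → u ∈T T → length u ≤ N
    short u u∈S u∈T with length u ≤? N
    ... | yes |u|≤N = |u|≤N
    ... | no  |u|≰N = ⊥-elim (proj₂ bounded (pad u) (closed _ u prefix (u∈S , u∈T)))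
      where
      prefix : (pad u ↾ N) ⊑ u
      prefix = subst ((pad u ↾ N) ⊑_) (pad-⊏ u) (↾-⊑ (pad u) (<⇒≤ (≰⇒> |u|≰N)))

  -- Apply König's lemma to the strings lying on
  -- a branch of X inside U and on one outside U: an infinite branch of these
  -- would be a point of [X] at which U or its complement is not open.
  clopen⇒determined : ∀ X U → ClopenIn (Body X) U → ∃[ N ] Determined X U N
  clopen⇒determined X U (U-open , ∁U-open) = N , determined
    where
    Mixed : Str → Set
    Mixed u = ∃[ a ] ∃[ b ] (Body X a × Body X b × u ⊏ a × u ⊏ b × U a × ¬ U b)

    closed : ∀ s t → s ⊑ t → Mixed t → Mixed s
    closed s t s⊑t (a , b , a∈X , b∈X , t⊏a , t⊏b , Ua , ¬Ub) =
      a , b , a∈X , b∈X , ⊏-⊑ s t a s⊑t t⊏a , ⊏-⊑ s t b s⊑t t⊏b , Ua , ¬Ub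

    mixed⇒∈X : ∀ c → (∀ n → Mixed (c ↾ n)) → Body X c
    mixed⇒∈X c mixed n = let (a , _ , a∈X , _ , c↾n⊏a , _) = mixed n in subst (_∈T X) c↾n⊏a (a∈X _)

    noBranch : ∀ c → ¬ (∀ n → Mixed (c ↾ n))
    noBranch c mixed with em {U c}
    ... | yes Uc = let (N , nbhd) = U-open c (mixed⇒∈X c mixed) Uc
                       (_ , b , _ , b∈X , _ , c↾N⊏b , _ , ¬Ub) = mixed N
                   in ¬Ub (nbhd b b∈X (↾⊏⇒ c b N c↾N⊏b))
    ... | no ¬Uc = let (N , nbhd) = ∁U-open c (mixed⇒∈X c mixed) ¬Uc
                       (a , _ , a∈X , _ , c↾N⊏a , _ , Ua , _) = mixed N
                   in nbhd a a∈X (↾⊏⇒ c a N c↾N⊏a) Ua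

    bounded : ∃[ N ] (∀ a → ¬ Mixed (a ↾ N))
    bounded = König Mixed closed noBranch
    N = proj₁ bounded

    determined : Determined X U N
    determined a b a∈X b∈X a↾N≡b↾N Ua with em {U b}
    ... | yes Ub = Ub
    ... | no ¬Ub = ⊥-elim (proj₂ bounded a (a , b , a∈X , b∈X , ↾-⊏ a N , ↾⊏⇐ a b N (sym a↾N≡b↾N) , Ua , ¬Ub))

module ForcingNotion (em : ExcludedMiddle 0ℓ) (P : Tree → Set) (FN : IsForcingNotion P) where
  open Classical em

  perfect : ∀ T → P T → IsPerfect T
  perfect = proj₁ (proj₂ FN)

  isTree : ∀ T → P T → IsTree T
  isTree T T∈P = proj₁ (perfect T T∈P)

  restrict : ∀ T s → P T → s ∈T T → P (T ∣ s)
  restrict = proj₁ (proj₂ (proj₂ FN))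

  -- Every node s of a tree T of P lies on a branch: T ∣ s is again perfect,
  -- so it has no endpoints and we can follow it forever.
  branchThrough : ∀ T s → P T → s ∈T T → ∃[ b ] (Body T b × s ⊏ b)
  branchThrough T s T∈P s∈T =
    let (b , b∈T∣s) = infiniteBranch (_∈T (T ∣ s)) root (proj₁ (proj₂ (proj₂ (perfect (T ∣ s) T∣s∈P))))
    in b , body-∣⁻ T s b b∈T∣s
    where
    T∣s∈P : P (T ∣ s)
    T∣s∈P = restrict T s T∈P s∈T
    root : [] ∈T (T ∣ s)
    root = ∣-∈⁺ T s [] (isTree T T∈P [] s refl s∈T) (inj₂ refl)

  Body-⊆⇒⊆ : ∀ R S → P R → (∀ b → Body R b → Body S b) → R ⊆T S
  Body-⊆⇒⊆ R S R∈P [R]⊆[S] u u∈R =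
    let (b , b∈R , u⊏b) = branchThrough R u R∈P u∈R
    in subst (_∈T S) u⊏b ([R]⊆[S] b b∈R (length u))

  -- A relatively clopen U ⊆ [X] is partitioned by the restrictions X ∣ t to
  -- the strings t of length N that begin a branch of X in U, where N is such
  -- that U is determined by the first N bits.
  clopenPartition : ∀ X U → P X → ClopenIn (Body X) U →
    Partition (λ Q → P Q × (∀ b → Body Q b → U b)) (λ a → Body X a × U a)
  clopenPartition X U X∈P clopen = map (X ∣_) seeds , good , disjoint , cover
    where
    N = proj₁ (clopen⇒determined X U clopen)
    determined = proj₂ (clopen⇒determined X U clopen)

    Seed : Str → Set
    Seed t = ∃[ a ] (Body X a × U a × a ↾ N ≡ t)

    seeds : List Str
    seeds = filter (λ t → em {Seed t}) (strings N)

    goodPiece : ∀ {t} → Seed t → P (X ∣ t) × (∀ b → Body (X ∣ t) b → U b)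
    goodPiece {t} (a , a∈X , Ua , a↾N≡t) = restrict X t X∈P (subst (_∈T X) a↾N≡t (a∈X N)) ,
      λ b b∈X∣t → let (b∈X , t⊏b) = body-∣⁻ X t b b∈X∣t in determined a b a∈X b∈X (agree b t⊏b) Ua
      where
      agree : ∀ b → t ⊏ b → a ↾ N ≡ b ↾ N
      agree b t⊏b = begin
        a ↾ N          ≡⟨ a↾N≡t ⟩
        t              ≡⟨ sym t⊏b ⟩
        b ↾ length t   ≡⟨ cong (b ↾_) (trans (cong length (sym a↾N≡t)) (length-↾ a N)) ⟩
        b ↾ N          ∎
        where open ≡-Reasoning

    good : All (λ Q → P Q × (∀ b → Body Q b → U b)) (map (X ∣_) seeds)
    good = All.map⁺ (All.tabulate λ t∈ → goodPiece (proj₂ (∈-filter⁻ (λ t → em {Seed t}) {xs = strings N} t∈)))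

    disjoint : AllPairs Disj (map (X ∣_) seeds)
    disjoint = AllPairs.map⁺ (AllPairs.map (∣-incomparable X X _ _)
      (AllPairs.filter⁺ (λ t → em {Seed t}) (strings-incomparable N)))

    cover : ∀ a → Body X a × U a → Any (λ Q → Body Q a) (map (X ∣_) seeds)
    cover a (a∈X , Ua) = Any.map⁺ (lose seed (body-∣⁺ X (a ↾ N) a a∈X (↾-⊏ a N)))
      where
      seed : (a ↾ N) ∈ seeds
      seed = ∈-filter⁺ (λ t → em {Seed t})
        (subst (λ k → (a ↾ N) ∈ strings k) (length-↾ a N) (strings-complete (a ↾ N)))
        (a , a∈X , Ua , refl)

  -- Write S ≐ S′ ∣ s and T ≐ T′ ∣ t with S′, T′ ∈ A.  If
  -- S′ and T′ differ they are almost disjoint, hence so are S and T.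
  -- Otherwise s, t are comparable (restrictions to incomparable nodes have no
  -- common branch), and restriction to the longer node gives the smaller tree.
  special⇒comparable : Special P → ∀ S T → P S → P T → ¬ AlmostDisjoint S T → S ⊆T T ⊎ T ⊆T S
  special⇒comparable (A , _ , A-AD , P⇔) S T S∈P T∈P ¬ad
    with Equivalence.to (P⇔ S) S∈P | Equivalence.to (P⇔ T) T∈P
  ... | S′ , s , S′∈A , _ , S⊆S′∣s , S′∣s⊆S | T′ , t , T′∈A , _ , T⊆T′∣t , T′∣t⊆T
    with em {S′ ≐ T′}
  ... | no S′≭T′ = ⊥-elim (¬ad (AD-⊆ S′ T′ S T (A-AD S′ T′ S′∈A T′∈A S′≭T′)
                                  (⊆-trans S⊆S′∣s (∣-⊆ S′ s)) (⊆-trans T⊆T′∣t (∣-⊆ T′ t))))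
  ... | yes (S′⊆T′ , T′⊆S′) with s ⊑? t | t ⊑? s
  ...   | yes s⊑t | _       = inj₂ (⊆-trans T⊆T′∣t (⊆-trans (∣-mono S′ T′ s t T′⊆S′ s⊑t) S′∣s⊆S))
  ...   | no _    | yes t⊑s = inj₁ (⊆-trans S⊆S′∣s (⊆-trans (∣-mono T′ S′ t s S′⊆T′ t⊑s) T′∣t⊆T))
  ...   | no s⋢t  | no t⋢s  = ⊥-elim (¬ad (Disj⇒AD S T (isTree S S∈P) (isTree T T∈P)
          (Disj-⊆ (S′ ∣ s) (T′ ∣ t) S T (∣-incomparable S′ T′ s t (s⋢t , t⋢s)) S⊆S′∣s T⊆T′∣t)))

  -- Consequently [S] ∩ [T] is empty, all of [S], or all of [T].
  special⇒regular : Special P → Regular P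
  special⇒regular special S T S∈P T∈P with em {AlmostDisjoint S T}
  ... | yes ad = inj₁ (clopen-empty (Body S) (BodyMeet S T) λ a _ → AD⇒Disj S T ad a)
  ... | no ¬ad with special⇒comparable special S T S∈P T∈P ¬ad
  ...   | inj₁ S⊆T = inj₁ (clopen-full (Body S) (BodyMeet S T) λ a a∈S → a∈S , Body-⊆ S T S⊆T a a∈S)
  ...   | inj₂ T⊆S = inj₂ (clopen-full (Body T) (BodyMeet S T) λ a a∈T → Body-⊆ T S T⊆S a a∈T , a∈T)

  module Regularity (regular : Regular P) where

    below-both : ∀ S T Q → P Q × (∀ b → Body Q b → BodyMeet S T b) → P Q × Q ⊆T S × Q ⊆T T
    below-both S T Q (Q∈P , [Q]⊆[S]∩[T]) =
      Q∈P , Body-⊆⇒⊆ Q S Q∈P (λ b b∈Q → proj₁ ([Q]⊆[S]∩[T] b b∈Q)) ,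
            Body-⊆⇒⊆ Q T Q∈P (λ b b∈Q → proj₂ ([Q]⊆[S]∩[T] b b∈Q))

    meetPartition : ∀ S T → P S → P T → Partition (λ Q → P Q × Q ⊆T S × Q ⊆T T) (BodyMeet S T)
    meetPartition S T S∈P T∈P with regular S T S∈P T∈P
    ... | inj₁ clopen = let (Qs , good , disjoint , cover) = clopenPartition S (BodyMeet S T) S∈P clopen
                        in Qs , All.map (below-both S T _) good , disjoint , λ a a∈S∩T → cover a (proj₁ a∈S∩T , a∈S∩T)
    ... | inj₂ clopen = let (Qs , good , disjoint , cover) = clopenPartition T (BodyMeet S T) T∈P clopen
                        in Qs , All.map (below-both S T _) good , disjoint , λ a a∈S∩T → cover a (proj₂ a∈S∩T , a∈S∩T)

    -- Refining a finite family Rs of trees of P by one more tree T ∈ P: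
    -- partition each [R] ∩ [T].
    refine : ∀ T → P T → (Rs : List Tree) → All P Rs →
      Σ (List Tree) λ Qs → All (λ Q → P Q × Q ⊆T T × Any (Q ⊆T_) Rs) Qs
        × (AllPairs Disj Rs → AllPairs Disj Qs)
        × (∀ a → Body T a → Any (λ R → Body R a) Rs → Any (λ Q → Body Q a) Qs)
    refine T T∈P []       []           = [] , [] , (λ _ → []) , (λ _ _ ())
    refine T T∈P (R ∷ Rs) (R∈P ∷ Rs∈P) with meetPartition R T R∈P T∈P | refine T T∈P Rs Rs∈P
    ... | Qs₀ , good₀ , disjoint₀ , cover₀ | Qs , good , disjoint , cover =
      Qs₀ ++ Qs ,
      All.++⁺ (All.map (λ (Q∈P , Q⊆R , Q⊆T) → Q∈P , Q⊆T , here Q⊆R) good₀)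
              (All.map (λ (Q∈P , Q⊆T , below) → Q∈P , Q⊆T , there below) good) ,
      (λ { (R-disj ∷ Rs-disj) → AllPairs.++⁺ disjoint₀ (disjoint Rs-disj) (across R-disj) }) ,
      λ { a a∈T (here a∈R) → Any.++⁺ˡ (cover₀ a (a∈R , a∈T))
        ; a a∈T (there a∈Rs) → Any.++⁺ʳ Qs₀ (cover a a∈T a∈Rs) }
      where
      across : All (Disj R) Rs → All (λ Q → All (Disj Q) Qs) Qs₀
      across R-disj = All.tabulate λ {Q} Q∈ → All.tabulate λ {Q′} Q′∈ →
        let (_ , Q⊆R , _) = All.lookup good₀ Q∈
            (_ , _ , below) = All.lookup good Q′∈
            (R-disj-R′ , Q′⊆R′) = All.lookupAny R-disj below
        in Disj-⊆ R _ Q Q′ R-disj-R′ Q⊆R Q′⊆R′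

    -- (ii) in list form: [S 0] ∩ ... ∩ [S k] is partitioned by trees of P
    -- below every S i; refine the partition for S 1, ..., S k by S 0.
    intersectionPartition : ∀ k (S : Fin (suc k) → Tree) → (∀ i → P (S i)) →
      Partition (λ R → P R × ∀ i → R ⊆T S i) (λ a → ∀ i → Body (S i) a)
    intersectionPartition zero S S∈P =
      S zero ∷ [] , (S∈P zero , λ { zero → λ _ u∈ → u∈ }) ∷ [] , [] ∷ [] , λ a a∈S → here (a∈S zero)
    intersectionPartition (suc k) S S∈P
      with intersectionPartition k (λ i → S (suc i)) (λ i → S∈P (suc i))
    ... | Rs , good , disjoint , cover with refine (S zero) (S∈P zero) Rs (All.map proj₁ good)
    ... | Qs , good′ , disjoint′ , cover′ =
      Qs , All.map belowAll good′ , disjoint′ disjoint ,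
      λ a a∈S → cover′ a (a∈S zero) (cover a (λ i → a∈S (suc i)))
      where
      belowAll : ∀ {Q} → P Q × Q ⊆T S zero × Any (Q ⊆T_) Rs → P Q × ∀ i → Q ⊆T S i
      belowAll (Q∈P , Q⊆S₀ , below) = Q∈P , λ
        { zero    → Q⊆S₀
        ; (suc i) → let ((_ , R⊆S) , Q⊆R) = All.lookupAny good below in ⊆-trans Q⊆R (R⊆S i) }

    -- Refining a finite family by a finite union ⋃ₗ [T l]: refine by each T l
    -- and collect the pieces.
    refineByUnion : ∀ m (T : Fin m → Tree) → (∀ l → P (T l)) → (Rs : List Tree) → All P Rs →
      Cover (λ Q → P Q × (∃[ l ] Q ⊆T T l) × Any (Q ⊆T_) Rs)
            (λ a → (∃[ l ] Body (T l) a) × Any (λ R → Body R a) Rs)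
    refineByUnion zero    T T∈P Rs Rs∈P = [] , [] , λ { a ((() , _) , _) }
    refineByUnion (suc m) T T∈P Rs Rs∈P
      with refine (T zero) (T∈P zero) Rs Rs∈P | refineByUnion m (λ l → T (suc l)) (λ l → T∈P (suc l)) Rs Rs∈P
    ... | Qs₀ , good₀ , _ , cover₀ | Qs , good , cover =
      Qs₀ ++ Qs ,
      All.++⁺ (All.map (λ (Q∈P , Q⊆T₀ , below) → Q∈P , (zero , Q⊆T₀) , below) good₀)
              (All.map (λ (Q∈P , (l , Q⊆Tₗ) , below) → Q∈P , (suc l , Q⊆Tₗ) , below) good) ,
      λ { a ((zero  , a∈T₀) , a∈Rs) → Any.++⁺ˡ (cover₀ a a∈T₀ a∈Rs)
        ; a ((suc l , a∈Tₗ) , a∈Rs) → Any.++⁺ʳ Qs₀ (cover a ((l , a∈Tₗ) , a∈Rs)) }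

    -- (iii) in list form: ⋂ᵢ ⋃ₗ [𝒮 i l] is covered by trees of P each below
    -- some member of every 𝒮 i; refine the cover for 𝒮 1, ..., 𝒮 k by ⋃ₗ [𝒮 0 l].
    unionsIntersectionCover : ∀ k (m : Fin (suc k) → ℕ) (𝒮 : (i : Fin (suc k)) → Fin (m i) → Tree) →
      (∀ i l → P (𝒮 i l)) →
      Cover (λ R → P R × ∀ i → ∃[ l ] R ⊆T 𝒮 i l) (λ a → ∀ i → ∃[ l ] Body (𝒮 i l) a)
    unionsIntersectionCover zero m 𝒮 𝒮∈P =
      tabulate (𝒮 zero) , All.tabulate⁺ (λ l → 𝒮∈P zero l , λ { zero → l , λ _ u∈ → u∈ }) ,
      λ a a∈⋂ → let (l , a∈𝒮) = a∈⋂ zero in Any.tabulate⁺ l a∈𝒮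
    unionsIntersectionCover (suc k) m 𝒮 𝒮∈P
      with unionsIntersectionCover k (λ i → m (suc i)) (λ i → 𝒮 (suc i)) (λ i → 𝒮∈P (suc i))
    ... | Rs , good , cover with refineByUnion (m zero) (𝒮 zero) (𝒮∈P zero) Rs (All.map proj₁ good)
    ... | Qs , good′ , cover′ =
      Qs , All.map belowSome good′ , λ a a∈⋂ → cover′ a (a∈⋂ zero , cover a (λ i → a∈⋂ (suc i)))
      where
      belowSome : ∀ {Q} → P Q × (∃[ l ] Q ⊆T 𝒮 zero l) × Any (Q ⊆T_) Rs →
                  P Q × ∀ i → ∃[ l ] Q ⊆T 𝒮 i l
      belowSome (Q∈P , Q⊆𝒮₀ , below) = Q∈P , λ
        { zero    → Q⊆𝒮₀
        ; (suc i) → let ((_ , R⊆𝒮) , Q⊆R) = All.lookupAny good below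
                        (l , R⊆𝒮ᵢₗ) = R⊆𝒮 i
                    in l , ⊆-trans Q⊆R R⊆𝒮ᵢₗ }

    -- (i) Trees of P with a common branch a have a common lower bound in P:
    -- the piece of the partition of [S] ∩ [T] containing a.
    commonBelow : ∀ S T → P S → P T → ¬ AlmostDisjoint S T → ∃[ R ] (P R × R ⊆T S × R ⊆T T)
    commonBelow S T S∈P T∈P ¬ad =
      let (Qs , good , _ , cover) = meetPartition S T S∈P T∈P
          (a , a∈S∩T) = commonBranch
          a∈Q = cover a a∈S∩T
      in Any.lookup a∈Q , proj₁ (All.lookupAny good a∈Q)
      where
      commonBranch : ∃[ a ] BodyMeet S T a
      commonBranch = dne λ none → ¬ad (Disj⇒AD S T (isTree S S∈P) (isTree T T∈P) λ a a∈S∩T → none (a , a∈S∩T))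

    intersections : ∀ k (S : Fin (suc k) → Tree) → (∀ i → P (S i)) →
      ∃[ n ] Σ (Fin n → Tree) λ R →
        (∀ j → P (R j))
        × (∀ j j′ → j ≢ j′ → AlmostDisjoint (R j) (R j′))
        × (∀ a → (∀ i → Body (S i) a) ⇔ (∃[ j ] Body (R j) a))
    intersections k S S∈P =
      let (Rs , good , disjoint , cover) = intersectionPartition k S S∈P
          R∈P = λ j → proj₁ (All-lookup good j)
      in length Rs , lookup Rs , R∈P ,
         (λ j j′ j≢j′ → Disj⇒AD _ _ (isTree _ (R∈P j)) (isTree _ (R∈P j′))
                                  (AllPairs-lookup (λ {S} {T} → Disj-sym S T) disjoint j j′ j≢j′)) ,
         λ a → mk⇔ (λ a∈⋂ → Any⇒∃lookup (cover a a∈⋂))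
                   (λ (j , a∈Rⱼ) i → Body-⊆ _ _ (proj₂ (All-lookup good j) i) a a∈Rⱼ)

    unionsIntersections : ∀ k (m : Fin (suc k) → ℕ) (𝒮 : (i : Fin (suc k)) → Fin (m i) → Tree) →
      (∀ i l → P (𝒮 i l)) →
      ∃[ n ] Σ (Fin n → Tree) λ R →
        (∀ j → P (R j))
        × (∀ a → (∀ i → ∃[ l ] Body (𝒮 i l) a) ⇔ (∃[ j ] Body (R j) a))
        × (∀ i j → ∃[ l ] (R j ⊆T 𝒮 i l))
    unionsIntersections k m 𝒮 𝒮∈P =
      let (Rs , good , cover) = unionsIntersectionCover k m 𝒮 𝒮∈P
          below = λ j → proj₂ (All-lookup good j)
      in length Rs , lookup Rs , (λ j → proj₁ (All-lookup good j)) ,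
         (λ a → mk⇔ (λ a∈⋂⋃ → Any⇒∃lookup (cover a a∈⋂⋃))
                    (λ (j , a∈Rⱼ) i → let (l , Rⱼ⊆𝒮ᵢₗ) = below j i in l , Body-⊆ _ _ Rⱼ⊆𝒮ᵢₗ a a∈Rⱼ)) ,
         λ i j → below j i

lemma5p5 : ExcludedMiddle 0ℓ → (P : Tree → Set) → IsForcingNotion P →
    (Special P → ∀ S T → P S → P T → ¬ AlmostDisjoint S T → S ⊆T T ⊎ T ⊆T S)
    × (Special P → Regular P)
    × (Regular P →
        (∀ S T → P S → P T → ¬ AlmostDisjoint S T →
           ∃[ R ] (P R × R ⊆T S × R ⊆T T))
        × (∀ k (S : Fin (suc k) → Tree) → (∀ i → P (S i)) →
             ∃[ n ] Σ (Fin n → Tree) λ R →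
               (∀ j → P (R j))
               × (∀ j j′ → j ≢ j′ → AlmostDisjoint (R j) (R j′))
               × (∀ a → (∀ i → Body (S i) a) ⇔ (∃[ j ] Body (R j) a)))
        × (∀ k (m : Fin (suc k) → ℕ) (𝒮 : (i : Fin (suc k)) → Fin (m i) → Tree) →
             (∀ i l → P (𝒮 i l)) →
             ∃[ n ] Σ (Fin n → Tree) λ R →
               (∀ j → P (R j))
               × (∀ a → (∀ i → ∃[ l ] Body (𝒮 i l) a) ⇔ (∃[ j ] Body (R j) a))
               × (∀ i j → ∃[ l ] (R j ⊆T 𝒮 i l))))
lemma5p5 em P FN =
  special⇒comparable , special⇒regular ,
  λ regular → let open Regularity regular in commonBelow , intersections , unionsIntersections
  where open ForcingNotion em P FN
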